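{- Let $\lambda = \langle \lambda_1, \ldots, \lambda_\ell\rangle$ be an integer partition with $\ell$ parts. Then the Garsia--Remmel $q$-rook number $R_{\ell}(\lambda; q)$ has a unimodal sequence of coefficients.
   Context: An integer partition $\lambda = \langle \lambda_1, \ldots, \lambda_\ell\rangle$ is a finite nonincreasing sequence of positive integers; its Ferrers board is $B_\lambda := \{(i,j) : 1 \le i \le \ell,\ 1 \le j \le \lambda_i\}$ (matrix coordinates: $i$ is the row, $j$ the column). A placement of $k$ (nonattacking) rooks on $B_\lambda$ is a $k$-element subset $w \subseteq B_\lambda$ no two elements of which agree in either coordinate. The inversion number $\mathrm{inv}(w)$ is defined as follows: for each rook $(a,b) \in w$, delete from $B_\lambda$ all cells $(i,b)$ with $i \le a$ and all cells $(a,j)$ with $j \le b$; $\mathrm{inv}(w)$ is the number of cells of $B_\lambda$ not deleted. The Garsia--Remmel $q$-rook number is $R_k(\lambda; q) := \sum_{w} q^{\mathrm{inv}(w)}$, the sum over all placements $w$ of $k$ rooks on $B_\lambda$. A polynomial $a_N q^N + \cdots + a_1 q + a_0$ is unimodal if for some $m$ one has $a_N \le a_{N-1} \le \cdots \le a_m \ge a_{m-1} \ge \cdots \ge a_0$. -}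

module Defs where

open import Data.Bool using (Bool; true; false; _∧_; _∨_; not; if_then_else_)
open import Data.Nat using (ℕ; zero; suc; _≤_; _<_; _≥_; _≤ᵇ_; _≡ᵇ_)
open import Data.List using (List; []; _∷_; length; map; concatMap; filterᵇ; applyUpTo; zip; foldr)
open import Data.List.Relation.Unary.All using (All)
open import Data.Bool.ListAction using (all; any)
open import Data.List.Relation.Unary.Linked using (Linked)
open import Data.Product using (_×_; _,_; proj₁; proj₂; ∃-syntax)

IsPartition : List ℕ → Set
IsPartition λs = All (0 <_) λs × Linked _≥_ λs

-- Cells are pairs (row , column), 1-indexed (matrix coordinates).
Cell : Set
Cell = ℕ × ℕ

boardFrom : ℕ → List ℕ → List Cell
boardFrom i [] = []
boardFrom i (r ∷ rs) = applyUpTo (λ j → (i , suc j)) r Data.List.++ boardFrom (suc i) rs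

board : List ℕ → List Cell
board = boardFrom 1

-- All sublists of a list (= all subsets, since the board has no repetitions).
sublists : {A : Set} → List A → List (List A)
sublists [] = [] ∷ []
sublists (x ∷ xs) = let s = sublists xs in s Data.List.++ map (x ∷_) s

nonattackingPair : Cell → Cell → Bool
nonattackingPair (a , b) (c , d) = not (a ≡ᵇ c) ∧ not (b ≡ᵇ d)

nonattacking : List Cell → Bool
nonattacking [] = true
nonattacking (x ∷ xs) = all (nonattackingPair x) xs ∧ nonattacking xs

placements : List ℕ → ℕ → List (List Cell)
placements λs k = filterᵇ (λ w → (length w ≡ᵇ k) ∧ nonattacking w) (sublists (board λs))

deletedBy : Cell → Cell → Bool
deletedBy (i , j) (a , b) = ((j ≡ᵇ b) ∧ (i ≤ᵇ a)) ∨ ((i ≡ᵇ a) ∧ (j ≤ᵇ b))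

inv : List ℕ → List Cell → ℕ
inv λs w = length (filterᵇ (λ c → not (any (deletedBy c) w)) (board λs))

-- Coefficient of q^d in the Garsia–Remmel q-rook number R_k(λ; q).
rookCoeff : List ℕ → ℕ → ℕ → ℕ
rookCoeff λs k d = length (filterᵇ (λ w → inv λs w ≡ᵇ d) (placements λs k))

-- A polynomial, given by its coefficient function a (a d = coefficient of q^d,
-- zero for large d), is unimodal if its coefficients weakly increase up to
-- some index m and weakly decrease from m on.
Unimodal : (ℕ → ℕ) → Set
Unimodal a = ∃[ m ] ((∀ i → suc i ≤ m → a i ≤ a (suc i)) × (∀ i → m ≤ i → a (suc i) ≤ a i))

-- A placement of ℓ rooks on the ℓ rows of B_λ has exactly one rook in each row. Fix the rooks in rows
-- 2, …, ℓ: they occupy ℓ − 1 distinct columns, all ≤ λ₁, and the rook in row 1 deletes no cell below it.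
-- That rook must stand in one of the n = λ₁ − (ℓ − 1) free columns, and the cells of row 1 it leaves
-- undeleted are exactly the free columns to its right, whose number runs through 0, 1, …, n − 1. Hence
-- R_ℓ(λ; q) = (1 + q + ⋯ + q^(n−1)) · R_(ℓ−1)(⟨λ₂, …, λ_ℓ⟩; q), and unimodality follows by induction,
-- because multiplying a unimodal sequence a (with peak at m) by 1 + q + ⋯ + q^(n−1) gives a sequence b with
-- b (d+1) − b d = a (d+1) − a (d+1−n): b descends from d = m + n − 1 on, and a descent of b before that
-- point persists.

module Submission where

open import Defs
open import Data.Bool using (Bool; true; false; _∧_; _∨_; not; T)
open import Data.Bool.Properties
  using (∨-identityʳ; ∧-zeroʳ; ∧-identityʳ; ∧-assoc; ∧-conicalˡ; ∧-conicalʳ; not-injective; T-≡; ∨-∧-booleanAlgebra)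
open import Algebra.Lattice.Properties.BooleanAlgebra ∨-∧-booleanAlgebra using (deMorgan₂)
open import Data.Bool.ListAction using (all; any)
open import Data.List using (List; []; _∷_; _++_; length; map; filterᵇ; applyUpTo)
open import Data.List.Relation.Unary.All as All using (All; []; _∷_)
open import Data.List.Relation.Unary.All.Properties using (++⁺; map⁺; applyUpTo⁺₁; applyUpTo⁺₂)
open import Data.List.Relation.Unary.AllPairs using (AllPairs; []; _∷_)
open import Data.List.Relation.Unary.Linked.Properties using (Linked⇒AllPairs)
open import Data.Nat using (ℕ; zero; suc; _+_; _∸_; _≤_; _<_; _≥_; z≤n; s≤s; s≤s⁻¹; _≤ᵇ_; _≡ᵇ_)
open import Data.Nat.Properties
open import Algebra.Properties.CommutativeSemigroup +-commutativeSemigroup using (interchange)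
open import Data.Product using (_×_; _,_; proj₁; proj₂; ∃-syntax)
open import Data.Sum using (_⊎_; inj₁; inj₂; [_,_]′)
open import Data.Unit using (tt)
open import Function using (_∘_; Equivalence)
open import Relation.Nullary using (¬_; yes; no)
open import Relation.Nullary.Negation using (contradiction)
open import Relation.Binary.PropositionalEquality

private variable
  A B : Set

Unimodal-resp : ∀ {a b : ℕ → ℕ} → a ≗ b → Unimodal a → Unimodal b
Unimodal-resp a≗b (m , up , down) =
  m , (λ i le → subst₂ _≤_ (a≗b i) (a≗b (suc i)) (up i le))
    , (λ i le → subst₂ _≤_ (a≗b (suc i)) (a≗b i) (down i le))

module _ {a : ℕ → ℕ} {m : ℕ} where

  ascending⇒monotone : (∀ i → suc i ≤ m → a i ≤ a (suc i)) →
                       ∀ {x y} → x ≤ y → y ≤ m → a x ≤ a y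
  ascending⇒monotone up {y = y} x≤y y≤m with m≤n⇒m<n∨m≡n x≤y
  ... | inj₂ refl = ≤-refl
  ascending⇒monotone up {y = suc y} _ y+1≤m | inj₁ (s≤s x≤y) =
    ≤-trans (ascending⇒monotone up x≤y (<⇒≤ y+1≤m)) (up y y+1≤m)

  descending⇒antitone : (∀ i → m ≤ i → a (suc i) ≤ a i) →
                        ∀ {x y} → m ≤ x → x ≤ y → a y ≤ a x
  descending⇒antitone down m≤x x≤y with m≤n⇒m<n∨m≡n x≤y
  ... | inj₂ refl = ≤-refl
  descending⇒antitone down {y = suc y} m≤x _ | inj₁ (s≤s x≤y) =
    ≤-trans (down y (≤-trans m≤x x≤y)) (descending⇒antitone down m≤x x≤y)

AscendingBelow : (ℕ → ℕ) → ℕ → Set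
AscendingBelow b n = ∀ d → suc d ≤ n → b d ≤ b (suc d)

ascendingBelow⊎firstDescent : ∀ (b : ℕ → ℕ) n →
  AscendingBelow b n ⊎ ∃[ t ] (b (suc t) < b t × AscendingBelow b t)
ascendingBelow⊎firstDescent b zero = inj₁ (λ _ ())
ascendingBelow⊎firstDescent b (suc n) with ascendingBelow⊎firstDescent b n | b n ≤? b (suc n)
... | inj₂ descent | _ = inj₂ descent
... | inj₁ asc | no b[n]≰b[n+1] = inj₂ (n , ≰⇒> b[n]≰b[n+1] , asc)
... | inj₁ asc | yes b[n]≤b[n+1] = inj₁ extend
  where
  extend : AscendingBelow b (suc n)
  extend d d<n+1 with m≤n⇒m<n∨m≡n (s≤s⁻¹ d<n+1)
  ... | inj₁ d<n = asc d d<n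
  ... | inj₂ refl = b[n]≤b[n+1]

unimodal-if-descents-persist :
  ∀ (b : ℕ → ℕ) K →
  (∀ d → K ≤ d → b (suc d) ≤ b d) →
  (∀ d → b (suc d) < b d → b (suc (suc d)) < b (suc d) ⊎ K ≤ suc d) →
  Unimodal b
unimodal-if-descents-persist b K descends-beyond persists with ascendingBelow⊎firstDescent b K
... | inj₁ asc = K , asc , descends-beyond
... | inj₂ (t , descent , asc) = t , asc , λ i t≤i → [ <⇒≤ , descends-beyond i ]′ (persist i t≤i)
  where
  persist : ∀ i → t ≤ i → b (suc i) < b i ⊎ K ≤ i
  persist i t≤i with m≤n⇒m<n∨m≡n t≤i
  persist i _ | inj₂ refl = inj₁ descent
  persist (suc i) _ | inj₁ (s≤s t≤i) = [ persists i , inj₂ ∘ m≤n⇒m≤1+n ]′ (persist i t≤i)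

-- ([ n ]q· a) d is the coefficient of q^d in (1 + q + ⋯ + q^(n-1)) · Σ_d a d q^d.
[_]q·_ : ℕ → (ℕ → ℕ) → ℕ → ℕ
([ zero ]q· a) d = 0
([ suc n ]q· a) zero = a zero
([ suc n ]q· a) (suc d) = a (suc d) + ([ n ]q· a) d

shift : ℕ → (ℕ → ℕ) → ℕ → ℕ
shift zero a d = a d
shift (suc k) a zero = 0
shift (suc k) a (suc d) = shift k a d

shift-+ : ∀ k a j → shift k a (k + j) ≡ a j
shift-+ zero a j = refl
shift-+ (suc k) a j = shift-+ k a j

shift-< : ∀ {k d} a → d < k → shift k a d ≡ 0
shift-< {suc k} {zero} a _ = refl
shift-< {suc k} {suc d} a (s≤s d<k) = shift-< a d<k

[suc]q· : ∀ k a d → ([ suc k ]q· a) d ≡ ([ k ]q· a) d + shift k a d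
[suc]q· zero a zero = refl
[suc]q· zero a (suc d) = +-identityʳ _
[suc]q· (suc k) a zero = sym (+-identityʳ _)
[suc]q· (suc k) a (suc d) = trans (cong (a (suc d) +_) ([suc]q· k a d)) (sym (+-assoc (a (suc d)) _ _))

-- b (d+1) − b d = a (d+1) − a (d−k) for b = [ k+1 ]q· a, with both sides moved so that no subtraction occurs.
[suc]q·-step : ∀ k a d → ([ suc k ]q· a) (suc d) + shift k a d ≡ a (suc d) + ([ suc k ]q· a) d
[suc]q·-step k a d = trans (+-assoc (a (suc d)) _ _) (cong (a (suc d) +_) (sym ([suc]q· k a d)))

balance-≤ : ∀ {x y u v} → x + v ≡ u + y → u ≤ v → x ≤ y
balance-≤ {x} {y} {u} {v} balance u≤v = +-cancelʳ-≤ v x y (begin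
  x + v ≡⟨ balance ⟩
  u + y ≤⟨ +-monoˡ-≤ y u≤v ⟩
  v + y ≡⟨ +-comm v y ⟩
  y + v ∎)
  where open ≤-Reasoning

balance-< : ∀ {x y u v} → x + v ≡ u + y → u < v → x < y
balance-< {x} {y} {u} {v} balance u<v = +-cancelʳ-< v x y (begin-strict
  x + v ≡⟨ balance ⟩
  u + y <⟨ +-monoˡ-< y u<v ⟩
  v + y ≡⟨ +-comm v y ⟩
  y + v ∎)
  where open ≤-Reasoning

balance-<⁻¹ : ∀ {x y u v} → x + v ≡ u + y → x < y → u < v
balance-<⁻¹ {x} {y} {u} {v} balance x<y =
  ≰⇒> (λ v≤u → <⇒≱ x<y (balance-≤ (trans (+-comm y u) (trans (sym balance) (+-comm x v))) v≤u))

unimodal-[]q· : ∀ {a} → Unimodal a → ∀ n → Unimodal ([ n ]q· a)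
unimodal-[]q· _ zero = 0 , (λ _ ()) , (λ _ _ → z≤n)
unimodal-[]q· {a} (m , up , down) (suc k) =
  unimodal-if-descents-persist b (m + k) descends-beyond persists
  where
  open ≤-Reasoning
  b : ℕ → ℕ
  b = [ suc k ]q· a

  descends-beyond : ∀ d → m + k ≤ d → b (suc d) ≤ b d
  descends-beyond d m+k≤d with m≤n⇒∃[o]m+o≡n (≤-trans (m≤n+m k m) m+k≤d)
  ... | j , refl = balance-≤ ([suc]q·-step k a (k + j)) (begin
    a (suc (k + j))    ≤⟨ descending⇒antitone down m≤j (m≤n⇒m≤1+n (m≤n+m j k)) ⟩
    a j                ≡⟨ shift-+ k a j ⟨
    shift k a (k + j)  ∎)
    where
    m≤j : m ≤ j
    m≤j = +-cancelʳ-≤ k m j (subst (m + k ≤_) (+-comm k j) m+k≤d)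

  persistsAt : ∀ j → a (suc (k + j)) < a j →
               b (suc (suc (k + j))) < b (suc (k + j)) ⊎ m + k ≤ suc (k + j)
  persistsAt j a-desc with m ≤? j | m ≤? suc (k + j)
  ... | yes m≤j | _ = inj₂ (m≤n⇒m≤1+n (subst (m + k ≤_) (+-comm j k) (+-monoˡ-≤ k m≤j)))
  ... | no m≰j | no m≰d+1 =
    contradiction (ascending⇒monotone up (m≤n⇒m≤1+n (m≤n+m j k)) (<⇒≤ (≰⇒> m≰d+1))) (<⇒≱ a-desc)
  ... | no m≰j | yes m≤d+1 = inj₁ (balance-< ([suc]q·-step k a (suc (k + j))) (begin-strict
    a (suc (suc (k + j)))    ≤⟨ down (suc (k + j)) m≤d+1 ⟩
    a (suc (k + j))          <⟨ a-desc ⟩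
    a j                      ≤⟨ up j (≰⇒> m≰j) ⟩
    a (suc j)                ≡⟨ shift-+ k a (suc j) ⟨
    shift k a (k + suc j)    ≡⟨ cong (shift k a) (+-suc k j) ⟩
    shift k a (suc (k + j))  ∎))

  persists : ∀ d → b (suc d) < b d → b (suc (suc d)) < b (suc d) ⊎ m + k ≤ suc d
  persists d b-desc with balance-<⁻¹ ([suc]q·-step k a d) b-desc | k ≤? d
  ... | a<shift | no k≰d = contradiction (subst (a (suc d) <_) (shift-< a (≰⇒> k≰d)) a<shift) n≮0
  ... | a<shift | yes k≤d with m≤n⇒∃[o]m+o≡n k≤d
  ... | j , refl = persistsAt j (subst (a (suc (k + j)) <_) (shift-+ k a j) a<shift)

χ : Bool → ℕ
χ true = 1
χ false = 0

δ : ℕ → ℕ → ℕ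
δ I d = χ (I ≡ᵇ d)

¬T⇒false : ∀ {b} → ¬ T b → b ≡ false
¬T⇒false {false} _ = refl
¬T⇒false {true} ¬t = contradiction tt ¬t

≤ᵇ-true : ∀ {m n} → m ≤ n → (m ≤ᵇ n) ≡ true
≤ᵇ-true m≤n = Equivalence.to T-≡ (≤⇒≤ᵇ m≤n)

≤ᵇ-false : ∀ {m n} → n < m → (m ≤ᵇ n) ≡ false
≤ᵇ-false {m} {n} n<m = ¬T⇒false (<⇒≱ n<m ∘ ≤ᵇ⇒≤ m n)

≡ᵇ-refl : ∀ m → (m ≡ᵇ m) ≡ true
≡ᵇ-refl m = Equivalence.to T-≡ (≡⇒≡ᵇ m m refl)

≡ᵇ-false : ∀ {m n} → m ≢ n → (m ≡ᵇ n) ≡ false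
≡ᵇ-false {m} {n} m≢n = ¬T⇒false (m≢n ∘ ≡ᵇ⇒≡ m n)

≡ᵇ-true⇒≡ : ∀ {m n} → (m ≡ᵇ n) ≡ true → m ≡ n
≡ᵇ-true⇒≡ {m} {n} eq = ≡ᵇ⇒≡ m n (Equivalence.from T-≡ eq)

χ-∧-≤ : ∀ a b → χ (a ∧ b) ≤ χ a
χ-∧-≤ false _ = z≤n
χ-∧-≤ true false = z≤n
χ-∧-≤ true true = ≤-refl

∑ : List A → (A → ℕ) → ℕ
∑ [] f = 0
∑ (x ∷ xs) f = f x + ∑ xs f

syntax ∑ xs (λ x → e) = ∑[ x ∈ xs ] e

∑< : ℕ → (ℕ → ℕ) → ℕ
∑< zero h = 0
∑< (suc r) h = ∑< r h + h r

syntax ∑< r (λ t → e) = ∑[ t < r ] e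

∑-++ : ∀ xs ys (f : A → ℕ) → ∑ (xs ++ ys) f ≡ ∑ xs f + ∑ ys f
∑-++ [] ys f = refl
∑-++ (x ∷ xs) ys f = trans (cong (f x +_) (∑-++ xs ys f)) (sym (+-assoc (f x) _ _))

∑-map : ∀ (g : B → A) xs (f : A → ℕ) → ∑ (map g xs) f ≡ ∑ xs (f ∘ g)
∑-map g [] f = refl
∑-map g (x ∷ xs) f = cong (f (g x) +_) (∑-map g xs f)

∑-congᴬ : ∀ {P : A → Set} {xs} {f g : A → ℕ} → All P xs → (∀ {x} → P x → f x ≡ g x) → ∑ xs f ≡ ∑ xs g
∑-congᴬ [] _ = refl
∑-congᴬ (px ∷ pxs) f≡g = cong₂ _+_ (f≡g px) (∑-congᴬ pxs f≡g)

∑-cong : ∀ xs {f g : A → ℕ} → f ≗ g → ∑ xs f ≡ ∑ xs g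
∑-cong [] _ = refl
∑-cong (x ∷ xs) f≗g = cong₂ _+_ (f≗g x) (∑-cong xs f≗g)

∑-zero : ∀ (xs : List A) → ∑[ x ∈ xs ] 0 ≡ 0
∑-zero [] = refl
∑-zero (x ∷ xs) = ∑-zero xs

∑-distrib-+ : ∀ xs (f g : A → ℕ) → ∑[ x ∈ xs ] (f x + g x) ≡ ∑ xs f + ∑ xs g
∑-distrib-+ [] f g = refl
∑-distrib-+ (x ∷ xs) f g =
  trans (cong (f x + g x +_) (∑-distrib-+ xs f g)) (interchange (f x) (g x) (∑ xs f) (∑ xs g))

∑-mono : ∀ xs {f g : A → ℕ} → (∀ x → f x ≤ g x) → ∑ xs f ≤ ∑ xs g
∑-mono [] _ = z≤n
∑-mono (x ∷ xs) f≤g = +-mono-≤ (f≤g x) (∑-mono xs f≤g)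

length-filterᵇ : ∀ (p : A → Bool) xs → length (filterᵇ p xs) ≡ ∑[ x ∈ xs ] χ (p x)
length-filterᵇ p [] = refl
length-filterᵇ p (x ∷ xs) with p x
... | true = cong suc (length-filterᵇ p xs)
... | false = length-filterᵇ p xs

length-filterᵇ-filterᵇ : ∀ (p q : A → Bool) xs →
  length (filterᵇ q (filterᵇ p xs)) ≡ ∑[ x ∈ xs ] χ (p x ∧ q x)
length-filterᵇ-filterᵇ p q xs = trans (length-filterᵇ q (filterᵇ p xs)) (∑-filterᵇ xs)
  where
  ∑-filterᵇ : ∀ xs → ∑[ x ∈ filterᵇ p xs ] χ (q x) ≡ ∑[ x ∈ xs ] χ (p x ∧ q x)
  ∑-filterᵇ [] = refl
  ∑-filterᵇ (x ∷ xs) with p x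
  ... | true = cong (χ (q x) +_) (∑-filterᵇ xs)
  ... | false = ∑-filterᵇ xs

∑<-cong : ∀ r {h h′ : ℕ → ℕ} → (∀ t → t < r → h t ≡ h′ t) → ∑< r h ≡ ∑< r h′
∑<-cong zero _ = refl
∑<-cong (suc r) h≡h′ = cong₂ _+_ (∑<-cong r (λ t t<r → h≡h′ t (m≤n⇒m≤1+n t<r))) (h≡h′ r ≤-refl)

∑<-vanishing : ∀ r {h : ℕ → ℕ} → (∀ t → t < r → h t ≡ 0) → ∑< r h ≡ 0
∑<-vanishing zero _ = refl
∑<-vanishing (suc r) h≡0 =
  cong₂ _+_ (∑<-vanishing r (λ t t<r → h≡0 t (m≤n⇒m≤1+n t<r))) (h≡0 r ≤-refl)

∑<-distrib-+ : ∀ r (f g : ℕ → ℕ) → ∑[ t < r ] (f t + g t) ≡ ∑< r f + ∑< r g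
∑<-distrib-+ zero f g = refl
∑<-distrib-+ (suc r) f g =
  trans (cong (_+ (f r + g r)) (∑<-distrib-+ r f g)) (interchange (∑< r f) (∑< r g) (f r) (g r))

∑-applyUpTo : ∀ (g : ℕ → A) r (f : A → ℕ) → ∑ (applyUpTo g r) f ≡ ∑[ t < r ] f (g t)
∑-applyUpTo g zero f = refl
∑-applyUpTo g (suc r) f = trans (cong (f (g 0) +_) (∑-applyUpTo (g ∘ suc) r f)) (sym (∑<-head r))
  where
  ∑<-head : ∀ r → ∑[ t < suc r ] f (g t) ≡ f (g 0) + ∑[ t < r ] f (g (suc t))
  ∑<-head zero = +-comm 0 (f (g 0))
  ∑<-head (suc r) = trans (cong (_+ f (g (suc r))) (∑<-head r)) (+-assoc (f (g 0)) _ _)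

∑<-∑-comm : ∀ r vs (h : ℕ → A → ℕ) → ∑[ t < r ] ∑[ v ∈ vs ] h t v ≡ ∑[ v ∈ vs ] ∑[ t < r ] h t v
∑<-∑-comm zero vs h = sym (∑-zero vs)
∑<-∑-comm (suc r) vs h =
  trans (cong (_+ ∑ vs (h r)) (∑<-∑-comm r vs h)) (sym (∑-distrib-+ vs (λ v → ∑[ t < r ] h t v) (h r)))

[]q·-zero : ∀ n d → ([ n ]q· (λ _ → 0)) d ≡ 0
[]q·-zero zero d = refl
[]q·-zero (suc n) zero = refl
[]q·-zero (suc n) (suc d) = []q·-zero n d

[]q·-∑ : ∀ vs (g : A → ℕ → ℕ) n d → ([ n ]q· (λ e → ∑[ v ∈ vs ] g v e)) d ≡ ∑[ v ∈ vs ] ([ n ]q· g v) d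
[]q·-∑ vs g zero d = sym (∑-zero vs)
[]q·-∑ vs g (suc n) zero = refl
[]q·-∑ vs g (suc n) (suc d) =
  trans (cong (∑[ v ∈ vs ] g v (suc d) +_) ([]q·-∑ vs g n d))
        (sym (∑-distrib-+ vs (λ v → g v (suc d)) (λ v → ([ n ]q· g v) d)))

[suc]q·-δ : ∀ n I d → ([ suc n ]q· δ I) d ≡ ([ n ]q· δ (suc I)) d + δ I d
[suc]q·-δ zero I zero = refl
[suc]q·-δ zero I (suc d) = +-identityʳ _
[suc]q·-δ (suc n) I zero = refl
[suc]q·-δ (suc n) I (suc d) = begin
  δ I (suc d) + ([ suc n ]q· δ I) d               ≡⟨ cong (δ I (suc d) +_) ([suc]q·-δ n I d) ⟩
  δ I (suc d) + (([ n ]q· δ (suc I)) d + δ I d)  ≡⟨ +-comm (δ I (suc d)) _ ⟩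
  ([ n ]q· δ (suc I)) d + δ I d + δ I (suc d)    ≡⟨ cong (_+ δ I (suc d)) (+-comm _ (δ I d)) ⟩
  ([ suc n ]q· δ (suc I)) (suc d) + δ I (suc d)  ∎
  where open ≡-Reasoning

All-sublists : ∀ {P : A → Set} {xs} → All P xs → All (All P) (sublists xs)
All-sublists [] = [] ∷ []
All-sublists (px ∷ pxs) = ++⁺ (All-sublists pxs) (map⁺ (All.map (px ∷_) (All-sublists pxs)))

∑-sublists-++ : ∀ {P : A → Set} {xs} ys (f : List A → ℕ) → All P xs →
  (∀ {x y} w → P x → P y → f (x ∷ y ∷ w) ≡ 0) →
  ∑ (sublists (xs ++ ys)) f ≡ ∑ (sublists ys) f + ∑[ x ∈ xs ] ∑[ v ∈ sublists ys ] f (x ∷ v)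
∑-sublists-++ ys f [] _ = sym (+-identityʳ _)
∑-sublists-++ {xs = x ∷ xs} ys f (px ∷ pxs) kills = begin
  ∑ (S ++ map (x ∷_) S) f                               ≡⟨ ∑-++ S _ f ⟩
  ∑ S f + ∑ (map (x ∷_) S) f                            ≡⟨ cong (∑ S f +_) (∑-map (x ∷_) S f) ⟩
  ∑ S f + ∑ S (f ∘ (x ∷_))                              ≡⟨ cong₂ _+_ (∑-sublists-++ ys f pxs kills)
                                                             (∑-sublists-++ ys (f ∘ (x ∷_)) pxs (λ w py _ → kills (_ ∷ w) px py)) ⟩
  (∑ Sys f + R) + (∑ Sys (f ∘ (x ∷_)) + R′)             ≡⟨ cong (λ z → (∑ Sys f + R) + (∑ Sys (f ∘ (x ∷_)) + z)) R′≡0 ⟩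
  (∑ Sys f + R) + (∑ Sys (f ∘ (x ∷_)) + 0)              ≡⟨ rearrange (∑ Sys f) R (∑ Sys (f ∘ (x ∷_))) ⟩
  ∑ Sys f + (∑ Sys (f ∘ (x ∷_)) + R)                    ∎
  where
  open ≡-Reasoning
  S = sublists (xs ++ ys)
  Sys = sublists ys
  R = ∑[ y ∈ xs ] ∑[ v ∈ Sys ] f (y ∷ v)
  R′ = ∑[ y ∈ xs ] ∑[ v ∈ Sys ] f (x ∷ y ∷ v)
  R′≡0 : R′ ≡ 0
  R′≡0 = trans (∑-congᴬ pxs (λ py → trans (∑-cong Sys (λ v → kills v px py)) (∑-zero Sys))) (∑-zero xs)
  rearrange : ∀ a b c → (a + b) + (c + 0) ≡ a + (c + b)
  rearrange a b c = trans (cong ((a + b) +_) (+-identityʳ c)) (trans (+-assoc a b c) (cong (a +_) (+-comm b c)))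

isPlacement : ℕ → List Cell → Bool
isPlacement k w = (length w ≡ᵇ k) ∧ nonattacking w

invFrom : ℕ → List ℕ → List Cell → ℕ
invFrom i λs w = length (filterᵇ (λ c → not (any (deletedBy c) w)) (boardFrom i λs))

rookCoeffFrom : ℕ → List ℕ → ℕ → ℕ
rookCoeffFrom i λs d =
  ∑[ w ∈ sublists (boardFrom i λs) ] χ (isPlacement (length λs) w ∧ (invFrom i λs w ≡ᵇ d))

usesColumn : List Cell → ℕ → Bool
usesColumn v j = any (λ c → j ≡ᵇ proj₂ c) v

count : ℕ → (ℕ → Bool) → ℕ
count r p = ∑[ t < r ] χ (p (suc t))

freeRightOf : ℕ → (ℕ → Bool) → ℕ → ℕ
freeRightOf r occupied b = count r (λ j → not ((j ≤ᵇ b) ∨ occupied j))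

BelowRow : ℕ → Cell → Set
BelowRow i c = i < proj₁ c

InColumns : ℕ → Cell → Set
InColumns r c = 1 ≤ proj₂ c × proj₂ c ≤ r

boardFrom-rows : ∀ i rs → All (BelowRow i) (boardFrom (suc i) rs)
boardFrom-rows i [] = []
boardFrom-rows i (r ∷ rs) =
  ++⁺ (applyUpTo⁺₂ _ r (λ _ → ≤-refl)) (All.map <⇒≤ (boardFrom-rows (suc i) rs))

boardFrom-columns : ∀ {r} j rs → All (_≤ r) rs → All (InColumns r) (boardFrom j rs)
boardFrom-columns j [] [] = []
boardFrom-columns j (r′ ∷ rs) (r′≤r ∷ rs≤r) =
  ++⁺ (applyUpTo⁺₁ _ r′ (λ t<r′ → s≤s z≤n , ≤-trans t<r′ r′≤r)) (boardFrom-columns (suc j) rs rs≤r)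

∑-sublists-boardFrom-∷ : ∀ i r rs (f : List Cell → ℕ) →
  (∀ {x y} w → proj₁ x ≡ proj₁ y → f (x ∷ y ∷ w) ≡ 0) →
  ∑ (sublists (boardFrom i (r ∷ rs))) f ≡
  ∑ (sublists (boardFrom (suc i) rs)) f + ∑[ t < r ] ∑[ v ∈ sublists (boardFrom (suc i) rs) ] f ((i , suc t) ∷ v)
∑-sublists-boardFrom-∷ i r rs f kills =
  trans (∑-sublists-++ _ f (applyUpTo⁺₂ {P = λ c → proj₁ c ≡ i} _ r (λ _ → refl)) (λ w px py → kills w (trans px (sym py))))
        (cong (_ +_) (∑-applyUpTo (λ t → (i , suc t)) r _))

isPlacement-sameRow : ∀ {k} x y w → proj₁ x ≡ proj₁ y → isPlacement k (x ∷ y ∷ w) ≡ false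
isPlacement-sameRow (a , b) (.a , c) w refl rewrite ≡ᵇ-refl a = ∧-zeroʳ _

χ-isPlacement-∷ : ∀ k x w → χ (isPlacement (suc k) (x ∷ w)) ≤ χ (isPlacement k w)
χ-isPlacement-∷ k x w = drop (length w ≡ᵇ k) (all (nonattackingPair x) w) (nonattacking w)
  where
  drop : ∀ a b c → χ (a ∧ (b ∧ c)) ≤ χ (a ∧ c)
  drop false _ _ = z≤n
  drop true false _ = z≤n
  drop true true _ = ≤-refl

noPlacements-tooManyRooks : ∀ j rs k → length rs < k →
  ∑[ w ∈ sublists (boardFrom j rs) ] χ (isPlacement k w) ≡ 0
noPlacements-tooManyRooks j [] (suc k) _ = refl
noPlacements-tooManyRooks j (r ∷ rs) (suc k) (s≤s ℓ<k) = begin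
  ∑[ w ∈ sublists (boardFrom j (r ∷ rs)) ] χ (isPlacement (suc k) w)
    ≡⟨ ∑-sublists-boardFrom-∷ j r rs _ (λ {x} {y} w same → cong χ (isPlacement-sameRow {suc k} x y w same)) ⟩
  ∑[ w ∈ rest ] χ (isPlacement (suc k) w) + ∑[ t < r ] ∑[ v ∈ rest ] χ (isPlacement (suc k) ((j , suc t) ∷ v))
    ≡⟨ cong₂ _+_ (noPlacements-tooManyRooks (suc j) rs (suc k) (m≤n⇒m≤1+n ℓ<k))
                 (∑<-vanishing r (λ t _ → n≤0⇒n≡0 (≤-trans (∑-mono rest (χ-isPlacement-∷ k (j , suc t)))
                                                          (≤-reflexive (noPlacements-tooManyRooks (suc j) rs k ℓ<k))))) ⟩
  0 ∎
  where
  open ≡-Reasoning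
  rest = sublists (boardFrom (suc j) rs)

all-nonattackingPair-below : ∀ {i} b v → All (BelowRow i) v →
  all (nonattackingPair (i , b)) v ≡ not (usesColumn v b)
all-nonattackingPair-below b [] [] = refl
all-nonattackingPair-below {i} b ((a , c) ∷ v) (i<a ∷ v-below) rewrite ≡ᵇ-false {i} {a} (<⇒≢ i<a) = begin
  not (b ≡ᵇ c) ∧ all (nonattackingPair (i , b)) v  ≡⟨ cong (not (b ≡ᵇ c) ∧_) (all-nonattackingPair-below b v v-below) ⟩
  not (b ≡ᵇ c) ∧ not (usesColumn v b)              ≡⟨ deMorgan₂ (b ≡ᵇ c) (usesColumn v b) ⟨
  not ((b ≡ᵇ c) ∨ usesColumn v b)                  ∎
  where open ≡-Reasoning

isPlacement-∷-below : ∀ {i} k b v → All (BelowRow i) v →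
  isPlacement (suc k) ((i , b) ∷ v) ≡ isPlacement k v ∧ not (usesColumn v b)
isPlacement-∷-below k b v v-below
  rewrite all-nonattackingPair-below b v v-below = swap (length v ≡ᵇ k) (not (usesColumn v b)) (nonattacking v)
  where
  swap : ∀ a b c → a ∧ (b ∧ c) ≡ (a ∧ c) ∧ b
  swap false _ _ = refl
  swap true false c = sym (∧-zeroʳ c)
  swap true true c = sym (∧-identityʳ c)

deletedBy-sameRow : ∀ i t b → deletedBy (i , t) (i , b) ≡ (t ≤ᵇ b)
deletedBy-sameRow i t b rewrite ≤ᵇ-true (≤-refl {i}) | ≡ᵇ-refl i with t ≡ᵇ b in t≡ᵇb
... | true = sym (≤ᵇ-true (≤-reflexive (≡ᵇ-true⇒≡ {t} {b} t≡ᵇb)))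
... | false = refl

any-deletedBy-below : ∀ {i} t v → All (BelowRow i) v → any (deletedBy (i , t)) v ≡ usesColumn v t
any-deletedBy-below t [] [] = refl
any-deletedBy-below {i} t ((a , c) ∷ v) (i<a ∷ v-below)
  rewrite ≤ᵇ-true (<⇒≤ i<a) | ≡ᵇ-false {i} {a} (<⇒≢ i<a) =
  cong₂ _∨_ (trans (∨-identityʳ _) (∧-identityʳ _)) (any-deletedBy-below t v v-below)

deletedBy-above : ∀ {i} c b → BelowRow i c → deletedBy c (i , b) ≡ false
deletedBy-above {i} (a , e) b i<a rewrite ≤ᵇ-false {a} {i} i<a | ≡ᵇ-false {a} {i} (>⇒≢ i<a) =
  trans (∨-identityʳ _) (∧-zeroʳ _)

invFrom-∷ : ∀ i r rs b v → All (BelowRow i) v →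
  invFrom i (r ∷ rs) ((i , b) ∷ v) ≡ freeRightOf r (usesColumn v) b + invFrom (suc i) rs v
invFrom-∷ i r rs b v v-below = begin
  length (filterᵇ kept (row ++ rest))   ≡⟨ length-filterᵇ kept (row ++ rest) ⟩
  ∑ (row ++ rest) (χ ∘ kept)            ≡⟨ ∑-++ row rest _ ⟩
  ∑ row (χ ∘ kept) + ∑ rest (χ ∘ kept)  ≡⟨ cong₂ _+_ inRow inRest ⟩
  freeRightOf r (usesColumn v) b + invFrom (suc i) rs v ∎
  where
  open ≡-Reasoning
  row = applyUpTo (λ t → (i , suc t)) r
  rest = boardFrom (suc i) rs
  kept : Cell → Bool
  kept c = not (any (deletedBy c) ((i , b) ∷ v))
  inRow : ∑ row (χ ∘ kept) ≡ freeRightOf r (usesColumn v) b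
  inRow = trans (∑-applyUpTo _ r _) (∑<-cong r (λ t _ → cong (χ ∘ not)
    (cong₂ _∨_ (deletedBy-sameRow i (suc t) b) (any-deletedBy-below (suc t) v v-below))))
  inRest : ∑ rest (χ ∘ kept) ≡ invFrom (suc i) rs v
  inRest = trans (∑-congᴬ (boardFrom-rows i rs) (λ {c} c-below →
                   cong (λ z → χ (not (z ∨ any (deletedBy c) v))) (deletedBy-above c b c-below)))
                 (sym (length-filterᵇ _ rest))

count-not+count : ∀ r p → count r (not ∘ p) + count r p ≡ r
count-not+count zero p = refl
count-not+count (suc r) p = begin
  count r (not ∘ p) + χ (not (p (suc r))) + (count r p + χ (p (suc r)))
    ≡⟨ interchange (count r (not ∘ p)) _ (count r p) _ ⟩
  count r (not ∘ p) + count r p + (χ (not (p (suc r))) + χ (p (suc r)))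
    ≡⟨ cong₂ _+_ (count-not+count r p) (χ-not+χ (p (suc r))) ⟩
  r + 1
    ≡⟨ +-comm r 1 ⟩
  suc r ∎
  where
  open ≡-Reasoning
  χ-not+χ : ∀ b → χ (not b) + χ b ≡ 1
  χ-not+χ true = refl
  χ-not+χ false = refl

count-not : ∀ r p → count r (not ∘ p) ≡ r ∸ count r p
count-not r p = trans (sym (m+n∸n≡m _ (count r p))) (cong (_∸ count r p) (count-not+count r p))

count-∨ : ∀ r (p q : ℕ → Bool) → (∀ j → p j ≡ true → q j ≡ false) →
  count r (λ j → p j ∨ q j) ≡ count r p + count r q
count-∨ r p q disjoint =
  trans (∑<-cong r (λ t _ → χ-∨ (p (suc t)) (q (suc t)) (disjoint (suc t)))) (∑<-distrib-+ r _ _)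
  where
  χ-∨ : ∀ a b → (a ≡ true → b ≡ false) → χ (a ∨ b) ≡ χ a + χ b
  χ-∨ true b disj rewrite disj refl = refl
  χ-∨ false b _ = refl

count-≡ᵇ : ∀ r {c} → 1 ≤ c → c ≤ r → count r (_≡ᵇ c) ≡ 1
count-≡ᵇ zero 1≤c c≤0 = contradiction (≤-trans 1≤c c≤0) λ ()
count-≡ᵇ (suc r) {c} 1≤c c≤r+1 with c ≟ suc r
... | yes refl = cong₂ _+_ (∑<-vanishing r (λ t t<r → cong χ (≡ᵇ-false (<⇒≢ (s≤s t<r))))) (cong χ (≡ᵇ-refl (suc r)))
... | no c≢r+1 = cong₂ _+_ (count-≡ᵇ r 1≤c (s≤s⁻¹ (≤∧≢⇒< c≤r+1 c≢r+1))) (cong χ (≡ᵇ-false (c≢r+1 ∘ sym)))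

usesColumn-nonattacking : ∀ a b v → all (nonattackingPair (a , b)) v ≡ true → usesColumn v b ≡ false
usesColumn-nonattacking a b [] _ = refl
usesColumn-nonattacking a b ((a′ , b′) ∷ v) safe =
  cong₂ _∨_ (not-injective (∧-conicalʳ (not (a ≡ᵇ a′)) _ (∧-conicalˡ _ _ safe)))
            (usesColumn-nonattacking a b v (∧-conicalʳ (nonattackingPair (a , b) (a′ , b′)) _ safe))

count-usesColumn : ∀ r v → All (InColumns r) v → nonattacking v ≡ true → count r (usesColumn v) ≡ length v
count-usesColumn r [] [] _ = ∑<-vanishing r (λ _ _ → refl)
count-usesColumn r ((a , b) ∷ v) ((1≤b , b≤r) ∷ v-cols) safe = begin
  count r (λ j → (j ≡ᵇ b) ∨ usesColumn v j)   ≡⟨ count-∨ r _ _ b-only ⟩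
  count r (_≡ᵇ b) + count r (usesColumn v)   ≡⟨ cong₂ _+_ (count-≡ᵇ r 1≤b b≤r)
                                                         (count-usesColumn r v v-cols (∧-conicalʳ _ _ safe)) ⟩
  suc (length v)                             ∎
  where
  open ≡-Reasoning
  b-only : ∀ j → (j ≡ᵇ b) ≡ true → usesColumn v j ≡ false
  b-only j j≡ᵇb rewrite ≡ᵇ-true⇒≡ {j} {b} j≡ᵇb = usesColumn-nonattacking a b v (∧-conicalˡ _ _ safe)

freeRightOf-suc : ∀ r occupied {t} → t < r →
  freeRightOf (suc r) occupied (suc t) ≡ freeRightOf r occupied (suc t) + χ (not (occupied (suc r)))
freeRightOf-suc r occupied {t} t<r =
  cong (λ z → freeRightOf r occupied (suc t) + χ (not (z ∨ occupied (suc r)))) (≤ᵇ-false (s≤s t<r))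

freeRightOf-last : ∀ r occupied → freeRightOf r occupied r ≡ 0
freeRightOf-last r occupied = ∑<-vanishing r (λ t t<r → cong (λ z → χ (not (z ∨ occupied (suc t)))) (≤ᵇ-true t<r))

[]q·δ-extend : ∀ b n I d → ([ n ]q· δ (χ b + I)) d + χ (b ∧ (I ≡ᵇ d)) ≡ ([ n + χ b ]q· δ I) d
[]q·δ-extend false n I d = trans (+-identityʳ _) (cong (λ m → ([ m ]q· δ I) d) (sym (+-identityʳ n)))
[]q·δ-extend true n I d = trans (sym ([suc]q·-δ n I d)) (cong (λ m → ([ m ]q· δ I) d) (+-comm 1 n))

-- As b runs over the n free columns, the number of free columns to the right of b runs through 0, 1, …, n − 1.
∑-freeColumns : ∀ (occupied : ℕ → Bool) r I d →
  ∑[ t < r ] χ (not (occupied (suc t)) ∧ (freeRightOf r occupied (suc t) + I ≡ᵇ d))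
  ≡ ([ count r (not ∘ occupied) ]q· δ I) d
∑-freeColumns occupied zero I d = refl
∑-freeColumns occupied (suc r) I d = begin
  ∑[ t < r ] χ (free (suc t) ∧ (freeRightOf (suc r) occupied (suc t) + I ≡ᵇ d))
    + χ (free (suc r) ∧ (freeRightOf (suc r) occupied (suc r) + I ≡ᵇ d))
    ≡⟨ cong₂ _+_ (∑<-cong r earlierColumn) lastColumn ⟩
  ∑[ t < r ] χ (free (suc t) ∧ (freeRightOf r occupied (suc t) + (χ (free (suc r)) + I) ≡ᵇ d))
    + χ (free (suc r) ∧ (I ≡ᵇ d))
    ≡⟨ cong (_+ χ (free (suc r) ∧ (I ≡ᵇ d))) (∑-freeColumns occupied r _ d) ⟩
  ([ count r free ]q· δ (χ (free (suc r)) + I)) d + χ (free (suc r) ∧ (I ≡ᵇ d))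
    ≡⟨ []q·δ-extend (free (suc r)) (count r free) I d ⟩
  ([ count (suc r) free ]q· δ I) d ∎
  where
  open ≡-Reasoning
  free = not ∘ occupied
  earlierColumn : ∀ t → t < r →
    χ (free (suc t) ∧ (freeRightOf (suc r) occupied (suc t) + I ≡ᵇ d)) ≡
    χ (free (suc t) ∧ (freeRightOf r occupied (suc t) + (χ (free (suc r)) + I) ≡ᵇ d))
  earlierColumn t t<r = cong (λ n → χ (free (suc t) ∧ (n ≡ᵇ d))) (begin
    freeRightOf (suc r) occupied (suc t) + I                        ≡⟨ cong (_+ I) (freeRightOf-suc r occupied t<r) ⟩
    freeRightOf r occupied (suc t) + χ (free (suc r)) + I          ≡⟨ +-assoc (freeRightOf r occupied (suc t)) _ I ⟩
    freeRightOf r occupied (suc t) + (χ (free (suc r)) + I)        ∎)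
  lastColumn : χ (free (suc r) ∧ (freeRightOf (suc r) occupied (suc r) + I ≡ᵇ d)) ≡ χ (free (suc r) ∧ (I ≡ᵇ d))
  lastColumn = cong (λ n → χ (free (suc r) ∧ (n + I ≡ᵇ d))) (freeRightOf-last (suc r) occupied)

∑-rookInFirstRow : ∀ i r rs d v → All (BelowRow i) v → All (InColumns r) v →
  ∑[ t < r ] χ (isPlacement (suc (length rs)) ((i , suc t) ∷ v) ∧ (invFrom i (r ∷ rs) ((i , suc t) ∷ v) ≡ᵇ d))
  ≡ ([ r ∸ length rs ]q· (λ e → χ (isPlacement (length rs) v ∧ (invFrom (suc i) rs v ≡ᵇ e)))) d
∑-rookInFirstRow i r rs d v v-below v-cols =
  trans (∑<-cong r (λ t _ → summand t)) (byPlacement (isPlacement L v) refl)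
  where
  L = length rs
  I = invFrom (suc i) rs v
  contributes : ℕ → Bool
  contributes b = not (usesColumn v b) ∧ (freeRightOf r (usesColumn v) b + I ≡ᵇ d)
  summand : ∀ t → χ (isPlacement (suc L) ((i , suc t) ∷ v) ∧ (invFrom i (r ∷ rs) ((i , suc t) ∷ v) ≡ᵇ d))
                ≡ χ (isPlacement L v ∧ contributes (suc t))
  summand t = trans (cong₂ (λ p n → χ (p ∧ (n ≡ᵇ d))) (isPlacement-∷-below L (suc t) v v-below)
                                                      (invFrom-∷ i r rs (suc t) v v-below))
                    (cong χ (∧-assoc (isPlacement L v) (not (usesColumn v (suc t))) _))
  byPlacement : ∀ p → isPlacement L v ≡ p →
    ∑[ t < r ] χ (p ∧ contributes (suc t)) ≡ ([ r ∸ L ]q· (λ e → χ (p ∧ (I ≡ᵇ e)))) d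
  byPlacement false _ = trans (∑<-vanishing r (λ _ _ → refl)) (sym ([]q·-zero (r ∸ L) d))
  byPlacement true placed = trans (∑-freeColumns (usesColumn v) r I d) (cong (λ n → ([ n ]q· δ I) d) (begin
    count r (not ∘ usesColumn v)  ≡⟨ count-not r (usesColumn v) ⟩
    r ∸ count r (usesColumn v)    ≡⟨ cong (r ∸_) (count-usesColumn r v v-cols (∧-conicalʳ (length v ≡ᵇ L) _ placed)) ⟩
    r ∸ length v                  ≡⟨ cong (r ∸_) (≡ᵇ-true⇒≡ {length v} {L} (∧-conicalˡ _ (nonattacking v) placed)) ⟩
    r ∸ L                         ∎))
    where open ≡-Reasoning

rookCoeffFrom-∷ : ∀ i r rs → All (_≤ r) rs →
  rookCoeffFrom i (r ∷ rs) ≗ [ r ∸ length rs ]q· rookCoeffFrom (suc i) rs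
rookCoeffFrom-∷ i r rs rs≤r d = begin
  rookCoeffFrom i (r ∷ rs) d
    ≡⟨ ∑-sublists-boardFrom-∷ i r rs f (λ {x} {y} w same →
         cong (λ p → χ (p ∧ (invFrom i (r ∷ rs) (x ∷ y ∷ w) ≡ᵇ d))) (isPlacement-sameRow {suc L} x y w same)) ⟩
  ∑ rest f + ∑[ t < r ] ∑[ v ∈ rest ] f ((i , suc t) ∷ v)
    ≡⟨ cong₂ _+_ noRookInFirstRow (∑<-∑-comm r rest _) ⟩
  ∑[ v ∈ rest ] ∑[ t < r ] f ((i , suc t) ∷ v)
    ≡⟨ ∑-congᴬ (All.zip (All-sublists (boardFrom-rows i rs) , All-sublists (boardFrom-columns (suc i) rs rs≤r)))
               (λ {v} (v-below , v-cols) → ∑-rookInFirstRow i r rs d v v-below v-cols) ⟩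
  ∑[ v ∈ rest ] ([ r ∸ L ]q· (λ e → χ (isPlacement L v ∧ (invFrom (suc i) rs v ≡ᵇ e)))) d
    ≡⟨ []q·-∑ rest _ (r ∸ L) d ⟨
  ([ r ∸ L ]q· rookCoeffFrom (suc i) rs) d ∎
  where
  open ≡-Reasoning
  L = length rs
  rest = sublists (boardFrom (suc i) rs)
  f : List Cell → ℕ
  f w = χ (isPlacement (suc L) w ∧ (invFrom i (r ∷ rs) w ≡ᵇ d))
  noRookInFirstRow : ∑ rest f ≡ 0
  noRookInFirstRow = n≤0⇒n≡0 (≤-trans (∑-mono rest (λ w → χ-∧-≤ (isPlacement (suc L) w) _))
                                      (≤-reflexive (noPlacements-tooManyRooks (suc i) rs (suc L) ≤-refl)))

rookCoeffFrom-unimodal : ∀ i λs → AllPairs _≥_ λs → Unimodal (rookCoeffFrom i λs)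
rookCoeffFrom-unimodal i [] [] = 0 , (λ _ ()) , (λ _ _ → z≤n)
rookCoeffFrom-unimodal i (r ∷ rs) (rs≤r ∷ rs-sorted) =
  Unimodal-resp (λ d → sym (rookCoeffFrom-∷ i r rs rs≤r d))
                (unimodal-[]q· (rookCoeffFrom-unimodal (suc i) rs rs-sorted) (r ∸ length rs))

rookCoeff≗rookCoeffFrom : ∀ λs → rookCoeff λs (length λs) ≗ rookCoeffFrom 1 λs
rookCoeff≗rookCoeffFrom λs d =
  length-filterᵇ-filterᵇ (isPlacement (length λs)) (λ w → inv λs w ≡ᵇ d) (sublists (board λs))

proposition1 : (λs : List ℕ) → IsPartition λs → Unimodal (rookCoeff λs (length λs))
proposition1 λs (_ , nonincreasing) =
  Unimodal-resp (sym ∘ rookCoeff≗rookCoeffFrom λs)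
                (rookCoeffFrom-unimodal 1 λs (Linked⇒AllPairs (λ x≥y y≥z → ≤-trans y≥z x≥y) nonincreasing))
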